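{- Let $(P_i:\underline{X}_i\to\underline{Y}_i)_{i\in I}$ be any set-indexed family of problems. Then $P_j\leq_2\lceil P_i\rceil_{i\in I}$ for every $j\in I$, and whenever $Q$ is a problem with $P_i\leq_2 Q$ for all $i\in I$, then $\lceil P_i\rceil_{i\in I}\leq_2 Q$. Consequently $(\mathbb{P}_2,\leq_2)$ is a complete join-semilattice, the supremum of a set $S$ of elements being the class of $\lceil P\rceil_{P\in S}$ (taking representatives).
   Context: A partial function $F:\subseteq X\to Y$ is a function from $\operatorname{dom}(F)\subseteq X$ to $Y$; between topological spaces it is continuous if continuous on $\operatorname{dom}(F)$ with the subspace topology. A problem $P:\underline{X}\to\underline{Y}$ is a set of partial functions from $\underline{X}$ to $\underline{Y}$. For problems $P:\underline{X}_1\to\underline{Y}_1$, $Q:\underline{X}_2\to\underline{Y}_2$, $P\leq_2 Q$ means there are continuous partial functions $F:\subseteq\underline{X}_1\times\underline{Y}_2\to\underline{Y}_1$ and $G:\subseteq\underline{X}_1\to\underline{X}_2$ such that for every $g\in Q$ the partial function $x\mapsto F(x,g(G(x)))$ (defined exactly where all terms are defined) belongs to $P$. $\mathbb{P}_2$ is the class of equivalence classes of problems under $\leq_2$, partially ordered by $\leq_2$. The coproduct $\coprod_{i\in I}\underline{X}_i$ is $\bigcup_{i\in I}\{i\}\times X_i$ with the smallest topology containing all $\{i\}\times U$, $U$ open in $\underline{X}_i$. For partial functions $f_i:\subseteq\underline{X}_i\to\underline{Y}_i$, $\lceil f_i\rceil_{i\in I}:\subseteq\coprod_i\underline{X}_i\to\coprod_i\underline{Y}_i$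 is $(i,x)\mapsto(i,f_i(x))$ (defined iff $x\in\operatorname{dom}f_i$), and $\lceil P_i\rceil_{i\in I}=\{\lceil f_i\rceil_{i\in I}\mid f_i\in P_i\text{ for all }i\in I\}$. A complete join-semilattice is a partially ordered class in which every subset has a least upper bound. -}

module Defs where

open import Level using () renaming (suc to lsuc)
open import Data.Product using (Σ; _×_; _,_; proj₁; proj₂)
open import Data.Unit using (⊤)
open import Relation.Binary.PropositionalEquality using (_≡_; refl; cong)

Subset : Set → Set₁
Subset X = X → Set

_≐_ : {X : Set} → Subset X → Subset X → Set
U ≐ V = ∀ x → (U x → V x) × (V x → U x)

record Topology (X : Set) : Set₂ where
  field
    Open      : Subset X → Set₁
    -- subsets are equal iff they have the same elements
    open-resp : ∀ {U V} → U ≐ V → Open U → Open V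
    open-univ : Open (λ _ → ⊤)
    open-∩    : ∀ {U V} → Open U → Open V → Open (λ x → U x × V x)
    -- arbitrary unions (the empty union gives the empty set)
    open-⋃    : ∀ {J : Set} (U : J → Subset X) → (∀ j → Open (U j)) →
                Open (λ x → Σ J (λ j → U j x))

record Space : Set₂ where
  field
    Carrier  : Set
    topology : Topology Carrier
  open Topology topology public

open Space public

data Gen {X : Set} (B : Subset X → Set₁) : Subset X → Set₁ where
  basic : ∀ {U} → B U → Gen B U
  univ  : Gen B (λ _ → ⊤)
  inter : ∀ {U V} → Gen B U → Gen B V → Gen B (λ x → U x × V x)
  union : ∀ {J : Set} (U : J → Subset X) → (∀ j → Gen B (U j)) →
          Gen B (λ x → Σ J (λ j → U j x))
  resp  : ∀ {U V} → U ≐ V → Gen B U → Gen B V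

generated : {X : Set} → (Subset X → Set₁) → Topology X
generated B = record
  { Open = Gen B ; open-resp = resp ; open-univ = univ
  ; open-∩ = inter ; open-⋃ = union }

_⊗_ : Space → Space → Space
A ⊗ B = record
  { Carrier  = Carrier A × Carrier B
  ; topology = generated (λ W →
      Σ (Subset (Carrier A)) λ U → Σ (Subset (Carrier B)) λ V →
        Open A U × Open B V × (W ≐ (λ p → U (proj₁ p) × V (proj₂ p)))) }

inj-set : {I : Set} (X : I → Set) (i : I) → Subset (X i) → Subset (Σ I X)
inj-set X i U p = Σ (X i) λ y → U y × ((i , y) ≡ p)

∐ : (I : Set) → (I → Space) → Space
∐ I X = record
  { Carrier  = Σ I (λ i → Carrier (X i))
  ; topology = generated (λ W →
      Σ I λ i → Σ (Subset (Carrier (X i))) λ U →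
        Open (X i) U × (W ≐ inj-set (λ k → Carrier (X k)) i U)) }

record PFun (X Y : Set) : Set₁ where
  field
    dom : Subset X
    app : (x : X) → dom x → Y
    wd  : ∀ {x x'} (d : dom x) (d' : dom x') → x ≡ x' → app x d ≡ app x' d'

open PFun public

_≈ₚ_ : {X Y : Set} → PFun X Y → PFun X Y → Set
f ≈ₚ g = (∀ x → (dom f x → dom g x) × (dom g x → dom f x))
       × (∀ x (d : dom f x) (d' : dom g x) → app f x d ≡ app g x d')

-- continuity on dom(f) with the subspace topology
Continuous : (X Y : Space) → PFun (Carrier X) (Carrier Y) → Set₁
Continuous X Y f =
  ∀ (V : Subset (Carrier Y)) → Open Y V →
    Σ (Subset (Carrier X)) λ U → Open X U ×
      (∀ x (d : dom f x) → (V (app f x d) → U x) × (U x → V (app f x d)))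

record Problem (X Y : Space) : Set₂ where
  field
    mem      : PFun (Carrier X) (Carrier Y) → Set₁
    mem-resp : ∀ {f g} → f ≈ₚ g → mem f → mem g

open Problem public

compose : {X₁ Y₁ X₂ Y₂ : Set} → PFun (X₁ × Y₂) Y₁ → PFun X₂ Y₂ →
          PFun X₁ X₂ → PFun X₁ Y₁
compose F g G = record
  { dom = λ x → Σ (dom G x) λ d₁ → Σ (dom g (app G x d₁)) λ d₂ →
                  dom F (x , app g (app G x d₁) d₂)
  ; app = λ x d → app F (x , app g (app G x (proj₁ d)) (proj₁ (proj₂ d)))
                        (proj₂ (proj₂ d))
  ; wd  = λ { {x} {.x} (d₁ , d₂ , d₃) (e₁ , e₂ , e₃) refl →
              wd F d₃ e₃ (cong (x ,_) (wd g d₂ e₂ (wd G d₁ e₁ refl))) } }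

_≤₂_ : {X₁ Y₁ X₂ Y₂ : Space} → Problem X₁ Y₁ → Problem X₂ Y₂ → Set₁
_≤₂_ {X₁} {Y₁} {X₂} {Y₂} P Q =
  Σ (PFun (Carrier X₁ × Carrier Y₂) (Carrier Y₁)) λ F →
  Σ (PFun (Carrier X₁) (Carrier X₂)) λ G →
    Continuous (X₁ ⊗ Y₂) Y₁ F × Continuous X₁ X₂ G ×
    (∀ g → mem Q g → mem P (compose F g G))

⌈_⌉ₚ : {I : Set} {X Y : I → Set} → ((i : I) → PFun (X i) (Y i)) →
       PFun (Σ I X) (Σ I Y)
⌈ f ⌉ₚ = record
  { dom = λ p → dom (f (proj₁ p)) (proj₂ p)
  ; app = λ p d → proj₁ p , app (f (proj₁ p)) (proj₂ p) d
  ; wd  = λ { {i , x} {.i , .x} d d' refl → cong (i ,_) (wd (f i) d d' refl) } }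

-- ⌈ P_i ⌉_{i∈I} = { ⌈ f_i ⌉ | f_i ∈ P_i for all i }
-- (membership taken up to equality of partial functions, i.e. of graphs)
⌈_⌉ : {I : Set} {X Y : I → Space} → ((i : I) → Problem (X i) (Y i)) →
      Problem (∐ I X) (∐ I Y)
⌈_⌉ {I} {X} {Y} P = record
  { mem = λ h → Σ ((i : I) → PFun (Carrier (X i)) (Carrier (Y i))) λ f →
                  (∀ i → mem (P i) (f i)) × (⌈ f ⌉ₚ ≈ₚ h)
  ; mem-resp = λ { fg (f , fP , e) → f , fP ,
      ((λ x → (λ d → proj₁ (proj₁ fg x) (proj₁ (proj₁ e x) d)) ,
              (λ d → proj₂ (proj₁ e x) (proj₂ (proj₁ fg x) d))) ,
       λ x d d' → Relation.Binary.PropositionalEquality.trans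
          (proj₂ e x d (proj₁ (proj₁ e x) d))
          (proj₂ fg x (proj₁ (proj₁ e x) d) d')) } }
  where import Relation.Binary.PropositionalEquality

module Submission where

-- Proof idea.  ⌈ P ⌉ is the coproduct of the family P in (ℙ₂, ≤₂):
--  * P j ≤₂ ⌈ P ⌉ : send an instance x of P j to (j , x); from an answer
--    (i , y) of ⌈ P ⌉ read off y, which is defined exactly when i ≡ j.
--    Restricting ⌈ f ⌉ₚ to the j-th summand gives back f j.
--  * if every P i ≤₂ Q via (F i , G i), then ⌈ P ⌉ ≤₂ Q via the cotuple
--    [ G i ] on the instance side and, on the answer side,
--    ⌈ F i ⌉ₚ precomposed with the distributivity map
--    (∐ X) × Y' → ∐ (X i × Y'); the resulting composite is exactly
--    ⌈ compose (F i) g (G i) ⌉ₚ, whose components solve P i.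

open import Defs
open import Data.Product using (Σ; _×_; _,_; proj₁; proj₂)
open import Data.Unit using (⊤; tt)
open import Function using (id)
open import Relation.Binary.PropositionalEquality using (_≡_; refl; cong; sym; subst)

ContinuousMap : (A B : Space) → (Carrier A → Carrier B) → Set₁
ContinuousMap A B h = ∀ V → Open B V → Open A (λ x → V (h x))

preimage-generated : (A : Space) {Y : Set} {B : Subset Y → Set₁} (h : Carrier A → Y) →
  (∀ {V} → B V → Open A (λ x → V (h x))) →
  ∀ {V} → Gen B V → Open A (λ x → V (h x))
preimage-generated A h onBasic (basic b)   = onBasic b
preimage-generated A h onBasic univ        = open-univ A
preimage-generated A h onBasic (inter u v) =
  open-∩ A (preimage-generated A h onBasic u) (preimage-generated A h onBasic v)
preimage-generated A h onBasic (union U o) =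
  open-⋃ A (λ k x → U k (h x)) (λ k → preimage-generated A h onBasic (o k))
preimage-generated A h onBasic (resp eq o) =
  open-resp A (λ x → eq (h x)) (preimage-generated A h onBasic o)

total : {X Y : Set} → (X → Y) → PFun X Y
total h = record { dom = λ _ → ⊤ ; app = λ x _ → h x ; wd = λ { _ _ refl → refl } }

_∘ₚ_ : {X Y Z : Set} → PFun Y Z → (X → Y) → PFun X Z
f ∘ₚ h = record { dom = λ x → dom f (h x) ; app = λ x d → app f (h x) d
                ; wd = λ { d d' refl → wd f d d' refl } }

_ₚ∘_ : {X Y Z : Set} → (Y → Z) → PFun X Y → PFun X Z
h ₚ∘ f = record { dom = dom f ; app = λ x d → h (app f x d)
                ; wd = λ d d' e → cong h (wd f d d' e) }

[_]ₚ : {I : Set} {X : I → Set} {Z : Set} → ((i : I) → PFun (X i) Z) → PFun (Σ I X) Z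
[ f ]ₚ = record { dom = λ p → dom (f (proj₁ p)) (proj₂ p)
                ; app = λ p d → app (f (proj₁ p)) (proj₂ p) d
                ; wd  = λ { {i , x} d d' refl → wd (f i) d d' refl } }

π : {I : Set} {Y : I → Set} (j : I) → PFun (Σ I Y) (Y j)
π {I} {Y} j = record { dom = λ p → proj₁ p ≡ j ; app = value ; wd = value-wd }
  where
  value : (p : Σ I Y) → proj₁ p ≡ j → Y j
  value (i , y) refl = y
  value-wd : ∀ {p p'} (d : proj₁ p ≡ j) (d' : proj₁ p' ≡ j) → p ≡ p' → value p d ≡ value p' d'
  value-wd {i , y} refl refl refl = refl

dist : {I : Set} {X : I → Set} {Z : Set} → Σ I X × Z → Σ I (λ i → X i × Z)
dist ((i , x) , z) = i , (x , z)

total-continuous : {A B : Space} {h : Carrier A → Carrier B} →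
  ContinuousMap A B h → Continuous A B (total h)
total-continuous {h = h} ch V oV = (λ x → V (h x)) , ch V oV , λ _ _ → id , id

precompose-continuous : {A B C : Space} {f : PFun (Carrier B) (Carrier C)}
  {h : Carrier A → Carrier B} →
  Continuous B C f → ContinuousMap A B h → Continuous A C (f ∘ₚ h)
precompose-continuous {h = h} cf ch V oV with cf V oV
... | U , oU , agree = (λ x → U (h x)) , ch U oU , λ x d → agree (h x) d

postcompose-continuous : {A B C : Space} {h : Carrier B → Carrier C}
  {f : PFun (Carrier A) (Carrier B)} →
  ContinuousMap B C h → Continuous A B f → Continuous A C (h ₚ∘ f)
postcompose-continuous {h = h} ch cf V oV = cf (λ y → V (h y)) (ch V oV)

proj₂-continuous : {A B : Space} → ContinuousMap (A ⊗ B) B proj₂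
proj₂-continuous {A} V oV =
  basic ((λ _ → ⊤) , V , open-univ A , oV , λ _ → (λ v → tt , v) , proj₂)

module _ {I : Set} {X : I → Space} where
  private
    CX : I → Set
    CX i = Carrier (X i)

  ∐-open : (U : (i : I) → Subset (CX i)) → (∀ i → Open (X i) (U i)) →
           Open (∐ I X) (λ p → U (proj₁ p) (proj₂ p))
  ∐-open U oU =
    resp (λ p → (λ { (i , x , u , refl) → u }) , (λ u → proj₁ p , proj₂ p , u , refl))
         (union (λ i → inj-set CX i (U i)) (λ i → basic (i , U i , oU i , λ _ → id , id)))

  -- the j-th slice of a subbasic open {i} × U is open: it is the union,
  -- over proofs of i ≡ j, of U transported to the j-th summand
  inj-set-slice-open : (j : I) {i : I} {U : Subset (CX i)} → Open (X i) U →
                       Open (X j) (λ x → inj-set CX i U (j , x))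
  inj-set-slice-open j {i} {U} oU =
    open-resp (X j) (λ x → into x , out x)
      (open-⋃ (X j) (λ e → subst (λ k → Subset (CX k)) e U) transported-open)
    where
    transported-open : (e : i ≡ j) → Open (X j) (subst (λ k → Subset (CX k)) e U)
    transported-open refl = oU
    into : (x : CX j) → Σ (i ≡ j) (λ e → subst (λ k → Subset (CX k)) e U x) →
           inj-set CX i U (j , x)
    into x (refl , u) = x , u , refl
    out : (x : CX j) → inj-set CX i U (j , x) →
          Σ (i ≡ j) (λ e → subst (λ k → Subset (CX k)) e U x)
    out x (.x , u , refl) = refl , u

  ι-continuous : (j : I) → ContinuousMap (X j) (∐ I X) (j ,_)
  ι-continuous j V oV =
    preimage-generated (X j) (j ,_) (λ { (i , U , oU , eq) →
      open-resp (X j) (λ x → proj₂ (eq (j , x)) , proj₁ (eq (j , x)))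
        (inj-set-slice-open j oU) }) oV

  π-continuous : (j : I) → Continuous (∐ I X) (X j) (π j)
  π-continuous j V oV =
    inj-set CX j V , basic (j , V , oV , λ _ → id , id) , agree
    where
    agree : ∀ p (d : proj₁ p ≡ j) → (V (app (π j) p d) → inj-set CX j V p) ×
                                     (inj-set CX j V p → V (app (π j) p d))
    agree (i , y) refl = (λ v → y , v , refl) , λ { (.y , v , refl) → v }

  cotuple-continuous : {Z : Space} {f : (i : I) → PFun (CX i) (Carrier Z)} →
    (∀ i → Continuous (X i) Z (f i)) → Continuous (∐ I X) Z [ f ]ₚ
  cotuple-continuous cf V oV =
    (λ p → proj₁ (cf (proj₁ p) V oV) (proj₂ p)) ,
    ∐-open (λ i → proj₁ (cf i V oV)) (λ i → proj₁ (proj₂ (cf i V oV))) ,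
    λ { (i , x) d → proj₂ (proj₂ (cf i V oV)) x d }

  module _ {Z : Space} where
    private
      CZ : Set
      CZ = Carrier Z

    ι×id-image : (i : I) → Subset (CX i × CZ) → Subset (Σ I CX × CZ)
    ι×id-image i W q = Σ (CX i) λ x → ((i , x) ≡ proj₁ q) × W (x , proj₂ q)

    ι×id-open : (i : I) {W : Subset (CX i × CZ)} → Open (X i ⊗ Z) W →
                Open (∐ I X ⊗ Z) (ι×id-image i W)
    ι×id-open i (basic (A , B , oA , oB , eq)) =
      basic (inj-set CX i A , B , basic (i , A , oA , λ _ → id , id) , oB , λ q →
        (λ { (x , e , w) → (x , proj₁ (proj₁ (eq _) w) , e) , proj₂ (proj₁ (eq _) w) }) ,
        (λ { ((x , a , e) , b) → x , e , proj₂ (eq _) (a , b) }))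
    ι×id-open i univ =
      basic (inj-set CX i (λ _ → ⊤) , (λ _ → ⊤) ,
             basic (i , (λ _ → ⊤) , open-univ (X i) , λ _ → id , id) , open-univ Z ,
             λ q → (λ { (x , e , _) → (x , tt , e) , tt }) , (λ { ((x , _ , e) , _) → x , e , tt }))
    ι×id-open i (inter {W} {W'} u v) =
      resp (λ q → meet q , λ { (x , e , w , w') → (x , e , w) , (x , e , w') })
        (inter (ι×id-open i u) (ι×id-open i v))
      where
      -- ι i is injective on each summand, so the two witnesses agree
      meet : ∀ q → ι×id-image i W q × ι×id-image i W' q → ι×id-image i (λ r → W r × W' r) q
      meet q ((x , refl , w) , (.x , refl , w')) = x , refl , w , w'
    ι×id-open i (union U o) =
      resp (λ q → (λ { (k , x , e , u) → x , e , k , u }) , (λ { (x , e , k , u) → k , x , e , u }))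
        (union (λ k → ι×id-image i (U k)) (λ k → ι×id-open i (o k)))
    ι×id-open i (resp eq o) =
      resp (λ q → (λ { (x , e , w) → x , e , proj₁ (eq _) w }) , (λ { (x , e , w) → x , e , proj₂ (eq _) w }))
        (ι×id-open i o)

    -- the distributivity map is continuous: the preimage of {i} × W is
    -- the image of W under ι i × id
    dist-continuous : ContinuousMap (∐ I X ⊗ Z) (∐ I (λ i → X i ⊗ Z)) dist
    dist-continuous V oV =
      preimage-generated (∐ I X ⊗ Z) dist (λ { (i , W , oW , eq) →
        resp (λ q → into i W eq q , out i W eq q) (ι×id-open i oW) }) oV
      where
      into : ∀ i W {V} → V ≐ inj-set _ i W → ∀ q → ι×id-image i W q → V (dist q)
      into i W eq ((.i , .x) , z) (x , refl , w) = proj₂ (eq _) ((x , z) , w , refl)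
      out : ∀ i W {V} → V ≐ inj-set _ i W → ∀ q → V (dist q) → ι×id-image i W q
      out i W eq ((k , x) , z) v with proj₁ (eq _) v
      ... | (.(x , z) , w , refl) = x , refl , w

-- ⌈ f ⌉ₚ is the cotuple of (i ,_) ∘ f i, hence continuous
⌈⌉-continuous : {I : Set} {X Y : I → Space} {f : (i : I) → PFun (Carrier (X i)) (Carrier (Y i))} →
  (∀ i → Continuous (X i) (Y i) (f i)) → Continuous (∐ I X) (∐ I Y) ⌈ f ⌉ₚ
⌈⌉-continuous {I} {X} {Y} {f} cf =
  cotuple-continuous {X = X} {Z = ∐ I Y} {f = λ i → (i ,_) ₚ∘ f i}
    (λ i → postcompose-continuous {X i} {Y i} {∐ I Y} {h = i ,_} {f = f i} (ι-continuous {X = Y} i) (cf i))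

module _ {I : Set} {X Y : I → Space} (P : (i : I) → Problem (X i) (Y i)) where
  private
    CX : I → Set
    CX i = Carrier (X i)
    CY : I → Set
    CY i = Carrier (Y i)

  ⌈⌉-restrict : (j : I) (f : (i : I) → PFun (CX i) (CY i)) (h : PFun (Σ I CX) (Σ I CY)) →
    ⌈ f ⌉ₚ ≈ₚ h → f j ≈ₚ compose (π j ∘ₚ proj₂) h (total (j ,_))
  ⌈⌉-restrict j f h (sameDom , sameApp) =
    (λ x → (λ d → tt , proj₁ (sameDom (j , x)) d ,
                  sym (cong proj₁ (sameApp (j , x) d (proj₁ (sameDom (j , x)) d)))) ,
           (λ { (_ , d , _) → proj₂ (sameDom (j , x)) d })) ,
    λ { x d (_ , d' , onJ) → read-back (sameApp (j , x) d d') onJ }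
    where
    read-back : ∀ {y : CY j} {p} → (j , y) ≡ p → (onJ : proj₁ p ≡ j) → y ≡ app (π j) p onJ
    read-back refl refl = refl

  summand-reduction : (j : I) → P j ≤₂ ⌈ P ⌉
  summand-reduction j = π j ∘ₚ proj₂ , total (j ,_) , F-continuous , G-continuous ,
    λ { h (f , fP , f≈h) → mem-resp (P j) (⌈⌉-restrict j f h f≈h) (fP j) }
    where
    F-continuous : Continuous (X j ⊗ ∐ I Y) (Y j) (π j ∘ₚ proj₂)
    F-continuous = precompose-continuous {X j ⊗ ∐ I Y} {∐ I Y} {Y j} {π j} {proj₂}
      (π-continuous {X = Y} j) (proj₂-continuous {X j} {∐ I Y})
    G-continuous : Continuous (X j) (∐ I X) (total (j ,_))
    G-continuous = total-continuous {X j} {∐ I X} {j ,_} (ι-continuous {X = X} j)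

  join-reduction : (X' Y' : Space) (Q : Problem X' Y') → ((i : I) → P i ≤₂ Q) → ⌈ P ⌉ ≤₂ Q
  join-reduction X' Y' Q red = F , G , F-continuous , G-continuous ,
    λ g gQ → (λ i → compose (Fᵢ i) g (Gᵢ i)) , (λ i → solvesᵢ i g gQ) , componentwise g
    where
    Fᵢ : (i : I) → PFun (CX i × Carrier Y') (CY i)
    Fᵢ i = proj₁ (red i)
    Gᵢ : (i : I) → PFun (CX i) (Carrier X')
    Gᵢ i = proj₁ (proj₂ (red i))
    solvesᵢ : (i : I) (g : PFun (Carrier X') (Carrier Y')) → mem Q g → mem (P i) (compose (Fᵢ i) g (Gᵢ i))
    solvesᵢ i = proj₂ (proj₂ (proj₂ (proj₂ (red i))))
    F : PFun (Σ I CX × Carrier Y') (Σ I CY)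
    F = ⌈ Fᵢ ⌉ₚ ∘ₚ dist
    G : PFun (Σ I CX) (Carrier X')
    G = [ Gᵢ ]ₚ
    F-continuous : Continuous (∐ I X ⊗ Y') (∐ I Y) F
    F-continuous = precompose-continuous {∐ I X ⊗ Y'} {∐ I (λ i → X i ⊗ Y')} {∐ I Y} {⌈ Fᵢ ⌉ₚ} {dist}
      (⌈⌉-continuous {X = λ i → X i ⊗ Y'} {Y} {Fᵢ} (λ i → proj₁ (proj₂ (proj₂ (red i)))))
      (dist-continuous {X = X} {Z = Y'})
    G-continuous : Continuous (∐ I X) X' G
    G-continuous = cotuple-continuous {X = X} {X'} {Gᵢ} (λ i → proj₁ (proj₂ (proj₂ (proj₂ (red i)))))
    componentwise : ∀ g → ⌈ (λ i → compose (Fᵢ i) g (Gᵢ i)) ⌉ₚ ≈ₚ compose F g G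
    componentwise g = (λ _ → id , id) , λ p d d' → wd (compose F g G) d d' refl

theorem4p9 : (I : Set) (X Y : I → Space) (P : (i : I) → Problem (X i) (Y i)) →
    ((j : I) → P j ≤₂ ⌈ P ⌉) ×
    ((X' Y' : Space) (Q : Problem X' Y') → ((i : I) → P i ≤₂ Q) → ⌈ P ⌉ ≤₂ Q)
theorem4p9 I X Y P = summand-reduction P , join-reduction P
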